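{- Let $n,k,u,v$ be integers with $1\le k,u,v\le n$ and $u\ne v$, and let $\alpha,\beta\in\mathcal X_{n,k}$. Consider the 3-color tomography instance on an $n\times(2n+2)$ grid with colors red ($R$), green ($G$), yellow ($Y$), whose red and green projections are, for $1\le i,j\le n$: $r^R_i=i+1$ if $i\in\{u,v\}$ and $r^R_i=i$ otherwise; $r^G_i=i$ if $i\in\{u,v\}$ and $r^G_i=i+1$ otherwise; $s^R_j=n-j+\alpha_j$, $s^G_j=0$; $s^R_{n+1}=1$, $s^G_{n+1}=n-1$; $s^R_{n+2}=n-k+1$, $s^G_{n+2}=k-1$; $s^R_{n+2+j}=0$, $s^G_{n+2+j}=n-j+1-\beta_j$; and whose yellow projections are $r^Y_i=2n+2-r^R_i-r^G_i$ and $s^Y_q=n-s^R_q-s^G_q$ for every column $q$. If this instance is feasible then $\alpha\preceq\beta$. Moreover, if $\alpha=\beta$, then the instance is feasible if and only if $\alpha_u+\alpha_v\ge 1$.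
   Context: $\mathcal X_{n,k}=\{x\in\{0,1\}^n:\sum_i x_i=k\}$. For $s,t\in\mathbb N^n$, $s\succeq t$ (equivalently $t\preceq s$) means $\sum_{j=1}^\ell s_j\ge\sum_{j=1}^\ell t_j$ for every $1\le\ell\le n$. A 3-color tomography instance on an $m\times n$ grid, given by vectors $r^c\in\mathbb N^m$, $s^c\in\mathbb N^n$ for $c\in\{R,G,Y\}$, is feasible if there is an $m\times n$ matrix $M$ with entries in $\{R,G,Y\}$ with $|\{j:M_{ij}=c\}|=r^c_i$ and $|\{i:M_{ij}=c\}|=s^c_j$ for all $i,j,c$. -}

module Defs where

open import Data.Nat using (ℕ; zero; suc; _+_; _∸_; _≤_; _<ᵇ_)
open import Data.Bool using (Bool; true; false; if_then_else_; _∨_)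
open import Data.Fin using (Fin; zero; suc; toℕ; splitAt)
open import Data.Fin.Properties using () renaming (_≟_ to _≟F_)
open import Data.Sum using (_⊎_; inj₁; inj₂)
open import Data.Product using (Σ; _×_)
open import Relation.Nullary.Decidable using (⌊_⌋)
open import Function using (_∘_)

sumF : {n : ℕ} → (Fin n → ℕ) → ℕ
sumF {zero}  f = 0
sumF {suc n} f = f zero + sumF (f ∘ suc)

count : {n : ℕ} → (Fin n → Bool) → ℕ
count p = sumF (λ j → if p j then 1 else 0)

-- X_{n,k}: 0/1 vectors of length n with exactly k ones
-- (index j : Fin n is the paper's coordinate toℕ j + 1)
X : (n k : ℕ) → (Fin n → ℕ) → Set
X n k x = ((j : Fin n) → x j ≤ 1) × sumF x ≡' k
  where
  open import Relation.Binary.PropositionalEquality using () renaming (_≡_ to _≡'_)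

prefix : {n : ℕ} → (Fin n → ℕ) → ℕ → ℕ
prefix t ℓ = sumF (λ j → if toℕ j <ᵇ ℓ then t j else 0)

_⪯_ : {n : ℕ} → (Fin n → ℕ) → (Fin n → ℕ) → Set
_⪯_ {n} t s = (ℓ : ℕ) → 1 ≤ ℓ → ℓ ≤ n → prefix t ℓ ≤ prefix s ℓ

data Color : Set where
  R G Y : Color

_==_ : Color → Color → Bool
R == R = true
G == G = true
Y == Y = true
_ == _ = false

Feasible : (m w : ℕ) → (Color → Fin m → ℕ) → (Color → Fin w → ℕ) → Set
Feasible m w r s =
  Σ (Fin m → Fin w → Color) λ M →
    ((i : Fin m) (c : Color) → count (λ j → M i j == c) ≡' r c i) ×
    ((j : Fin w) (c : Color) → count (λ i → M i j == c) ≡' s c j)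
  where
  open import Relation.Binary.PropositionalEquality using () renaming (_≡_ to _≡'_)

-- Row projections.  Row i : Fin n is the paper's row toℕ i + 1;
-- u, v : Fin n likewise.
rowR rowG : (n : ℕ) (u v : Fin n) → Fin n → ℕ
rowR n u v i = if ⌊ i ≟F u ⌋ ∨ ⌊ i ≟F v ⌋ then suc (suc (toℕ i)) else suc (toℕ i)
rowG n u v i = if ⌊ i ≟F u ⌋ ∨ ⌊ i ≟F v ⌋ then suc (toℕ i) else suc (suc (toℕ i))

rowProj : (n : ℕ) (u v : Fin n) → Color → Fin n → ℕ
rowProj n u v R i = rowR n u v i
rowProj n u v G i = rowG n u v i
rowProj n u v Y i = (2 + n + n) ∸ rowR n u v i ∸ rowG n u v i

-- Columns: Fin (n + (2 + n)), i.e. 2n+2 columns, split into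
--   inj₁ j           : paper column j+1            (j : Fin n)
--   inj₂ (inj₁ 0)    : paper column n+1
--   inj₂ (inj₁ 1)    : paper column n+2
--   inj₂ (inj₂ j)    : paper column n+2+(j+1)      (j : Fin n)
data Col (n : ℕ) : Set where
  first : Fin n → Col n
  mid   : Fin 2 → Col n
  last  : Fin n → Col n

classify : (n : ℕ) → Fin (n + (2 + n)) → Col n
classify n q with splitAt n q
... | inj₁ j = first j
... | inj₂ r with splitAt 2 r
...   | inj₁ t = mid t
...   | inj₂ j = last j

colRG : (n k : ℕ) (α β : Fin n → ℕ) → Color → Col n → ℕ
-- s^R_j = n - j + α_j, s^G_j = 0   (paper j = toℕ j + 1)
colRG n k α β R (first j) = (n ∸ suc (toℕ j)) + α j
colRG n k α β G (first j) = 0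
colRG n k α β R (mid zero) = 1
colRG n k α β G (mid zero) = n ∸ 1
colRG n k α β R (mid (suc zero)) = (n ∸ k) + 1
colRG n k α β G (mid (suc zero)) = k ∸ 1
-- s^R_{n+2+j} = 0, s^G_{n+2+j} = n - j + 1 - β_j   (paper j = toℕ j + 1)
colRG n k α β R (last j) = 0
colRG n k α β G (last j) = (n ∸ toℕ j) ∸ β j
-- yellow handled in colProj
colRG n k α β Y _ = 0

colProj : (n k : ℕ) (α β : Fin n → ℕ) → Color → Fin (n + (2 + n)) → ℕ
colProj n k α β Y q = n ∸ colRG n k α β R (classify n q) ∸ colRG n k α β G (classify n q)
colProj n k α β c q = colRG n k α β c (classify n q)

Instance : (n k : ℕ) (u v : Fin n) (α β : Fin n → ℕ) → Set
Instance n k u v α β = Feasible n (n + (2 + n)) (rowProj n u v) (colProj n k α β)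

-- Call a cell occupied when it is red or green.  Row i (0-based) must hold
-- exactly 2i+3 occupied cells, so the first ℓ rows hold rowsUpTo ℓ =
-- Σ_{m<ℓ} (2m+3) of them.  A column of kind x must hold s^R_x + s^G_x occupied
-- cells, and since only n-ℓ rows lie outside the first ℓ, at least
-- forced ℓ x = s^R_x + s^G_x - (n-ℓ) of them lie in the first ℓ rows.  A direct
-- computation with the column projections gives the counting identity
--   Σ_q forced ℓ q + prefix β ℓ = rowsUpTo ℓ + prefix α ℓ,
-- so feasibility forces prefix α ℓ ≤ prefix β ℓ for all ℓ, i.e. α ⪯ β.
-- When α = β all these bounds are attained, so a row w ∈ {u,v} with α_w = 0
-- has no red cell in first-block columns j ≥ w nor in the last block; its w+2
-- red cells then force a red cell in column n+1, which holds only one, hence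
-- α_u + α_v ≥ 1.  Conversely, for α = β and α_u + α_v ≥ 1 an explicit
-- staircase-shaped colouring (module Construction) realises all projections.
module Submission where

open import Defs
open import Data.Bool using (Bool; true; false; if_then_else_; _∨_; not)
open import Data.Bool.Properties using (∨-zeroʳ; not-involutive)
open import Data.Empty using (⊥-elim)
open import Data.Fin using (Fin; zero; suc; toℕ; splitAt; _↑ˡ_; _↑ʳ_)
open import Data.Fin.Properties using (splitAt-↑ˡ; splitAt-↑ʳ; toℕ<n; toℕ-injective)
  renaming (_≟_ to _≟F_)
open import Data.Nat
open import Data.Nat.Properties
open import Data.Nat.Tactic.RingSolver using (solve-∀)
open import Data.Product using (Σ; _×_; _,_; proj₁; proj₂)
open import Data.Sum using (_⊎_; inj₁; inj₂)
open import Function using (_∘_)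
open import Function.Bundles using (_⇔_; mk⇔)
open import Relation.Binary.Definitions using (tri<; tri≈; tri>)
open import Relation.Binary.PropositionalEquality
open import Relation.Nullary using (¬_; yes; no)
open import Relation.Nullary.Decidable using (⌊_⌋)

⟦_⟧ : Bool → ℕ
⟦ b ⟧ = if b then 1 else 0

⟦⟧≤1 : ∀ b → ⟦ b ⟧ ≤ 1
⟦⟧≤1 true  = s≤s z≤n
⟦⟧≤1 false = z≤n

⟦⟧+⟦not⟧ : ∀ b → ⟦ b ⟧ + ⟦ not b ⟧ ≡ 1
⟦⟧+⟦not⟧ true  = refl
⟦⟧+⟦not⟧ false = refl

if-+ : ∀ b (x y : ℕ) → (if b then x + y else 0) ≡ (if b then x else 0) + (if b then y else 0)
if-+ true  x y = refl
if-+ false x y = refl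

+-to-∸ : ∀ {x s m} → x + s ≡ m → x ≡ m ∸ s
+-to-∸ {x} {s} h = trans (sym (m+n∸n≡m x s)) (cong (_∸ s) h)

sumF-cong : ∀ {n} {f g : Fin n → ℕ} → (∀ j → f j ≡ g j) → sumF f ≡ sumF g
sumF-cong {zero}  e = refl
sumF-cong {suc n} e = cong₂ _+_ (e zero) (sumF-cong (e ∘ suc))

sumF-+ : ∀ {n} (f g : Fin n → ℕ) → sumF (λ j → f j + g j) ≡ sumF f + sumF g
sumF-+ {zero}  f g = refl
sumF-+ {suc n} f g rewrite sumF-+ (f ∘ suc) (g ∘ suc) =
  interchange (f zero) (g zero) (sumF (f ∘ suc)) (sumF (g ∘ suc))
  where
  interchange : ∀ a b c d → a + b + (c + d) ≡ a + c + (b + d)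
  interchange = solve-∀

sumF-mono : ∀ {n} {f g : Fin n → ℕ} → (∀ j → f j ≤ g j) → sumF f ≤ sumF g
sumF-mono {zero}  e = z≤n
sumF-mono {suc n} e = +-mono-≤ (e zero) (sumF-mono (e ∘ suc))

sumF-zero : ∀ n → sumF {n} (λ _ → 0) ≡ 0
sumF-zero zero    = refl
sumF-zero (suc n) = sumF-zero n

sumF-one : ∀ n → sumF {n} (λ _ → 1) ≡ n
sumF-one zero    = refl
sumF-one (suc n) = cong suc (sumF-one n)

sumF-if : ∀ {n} b (f : Fin n → ℕ) → sumF (λ j → if b then f j else 0) ≡ (if b then sumF f else 0)
sumF-if     true  f = refl
sumF-if {n} false f = sumF-zero n

sumF-++ : ∀ m k (f : Fin (m + k) → ℕ) →
          sumF f ≡ sumF (λ j → f (j ↑ˡ k)) + sumF (λ j → f (m ↑ʳ j))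
sumF-++ zero    k f = refl
sumF-++ (suc m) k f rewrite sumF-++ m k (f ∘ suc) = sym (+-assoc (f zero) _ _)

sumF-comm : ∀ m n (f : Fin m → Fin n → ℕ) →
            sumF (λ i → sumF (λ j → f i j)) ≡ sumF (λ j → sumF (λ i → f i j))
sumF-comm zero    n f = sym (sumF-zero n)
sumF-comm (suc m) n f rewrite sumF-comm m n (f ∘ suc) =
  sym (sumF-+ (f zero) (λ j → sumF (λ i → f (suc i) j)))

term≤sumF : ∀ {n} (f : Fin n → ℕ) a → f a ≤ sumF f
term≤sumF f zero    = m≤m+n _ _
term≤sumF f (suc a) = ≤-trans (term≤sumF (f ∘ suc) a) (m≤n+m _ _)

two-terms≤sumF : ∀ {n} (f : Fin n → ℕ) a b → ¬ a ≡ b → f a + f b ≤ sumF f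
two-terms≤sumF f zero    zero    a≢b = ⊥-elim (a≢b refl)
two-terms≤sumF f zero    (suc b) a≢b = +-monoʳ-≤ (f zero) (term≤sumF (f ∘ suc) b)
two-terms≤sumF f (suc a) zero    a≢b rewrite +-comm (f (suc a)) (f zero) =
  +-monoʳ-≤ (f zero) (term≤sumF (f ∘ suc) a)
two-terms≤sumF f (suc a) (suc b) a≢b =
  ≤-trans (two-terms≤sumF (f ∘ suc) a b (a≢b ∘ cong suc)) (m≤n+m _ _)

sumF-tight : ∀ {n} (f g : Fin n → ℕ) → (∀ j → g j ≤ f j) → sumF f ≤ sumF g → ∀ j → f j ≤ g j
sumF-tight f g g≤f Σf≤Σg zero =
  +-cancelʳ-≤ _ _ _ (≤-trans (+-monoʳ-≤ (f zero) (sumF-mono (g≤f ∘ suc))) Σf≤Σg)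
sumF-tight f g g≤f Σf≤Σg (suc j) =
  sumF-tight (f ∘ suc) (g ∘ suc) (g≤f ∘ suc)
    (+-cancelˡ-≤ (f zero) _ _ (≤-trans Σf≤Σg (+-monoˡ-≤ _ (g≤f zero)))) j

≟-refl : ∀ {n} (a : Fin n) → ⌊ a ≟F a ⌋ ≡ true
≟-refl a with a ≟F a
... | yes _   = refl
... | no  a≢a = ⊥-elim (a≢a refl)

≟-sym : ∀ {n} (a b : Fin n) → ⌊ a ≟F b ⌋ ≡ ⌊ b ≟F a ⌋
≟-sym a b with a ≟F b | b ≟F a
... | yes _   | yes _   = refl
... | no  _   | no  _   = refl
... | yes a≡b | no  b≢a = ⊥-elim (b≢a (sym a≡b))
... | no  a≢b | yes b≡a = ⊥-elim (a≢b (sym b≡a))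

≟-suc : ∀ {n} (i j : Fin n) → ⌊ suc j ≟F suc i ⌋ ≡ ⌊ j ≟F i ⌋
≟-suc i j with j ≟F i
... | yes _ = refl
... | no  _ = refl

sumF-pick : ∀ {n} (f : Fin n → ℕ) (i : Fin n) → sumF (λ j → if ⌊ j ≟F i ⌋ then f j else 0) ≡ f i
sumF-pick {suc n} f zero    = trans (cong (f zero +_) (sumF-zero n)) (+-identityʳ _)
sumF-pick {suc n} f (suc i) =
  trans (sumF-cong (λ j → cong (λ b → if b then f (suc j) else 0) (≟-suc i j)))
        (sumF-pick (f ∘ suc) i)

sumF-pickʳ : ∀ {n} (f : Fin n → ℕ) (j : Fin n) → sumF (λ i → if ⌊ j ≟F i ⌋ then f i else 0) ≡ f j
sumF-pickʳ f j =
  trans (sumF-cong (λ i → cong (λ b → if b then f i else 0) (≟-sym j i))) (sumF-pick f j)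

<ᵇ-true : ∀ {m n} → m < n → (m <ᵇ n) ≡ true
<ᵇ-true {zero}  {suc n} _         = refl
<ᵇ-true {suc m} {suc n} (s≤s m<n) = <ᵇ-true m<n

<ᵇ-false : ∀ {m n} → n ≤ m → (m <ᵇ n) ≡ false
<ᵇ-false {m}     {zero}  _         = refl
<ᵇ-false {suc m} {suc n} (s≤s n≤m) = <ᵇ-false n≤m

<ᵇ-flip : ∀ m i → (i <ᵇ suc m) ≡ not (m <ᵇ i)
<ᵇ-flip zero    zero    = refl
<ᵇ-flip zero    (suc i) = refl
<ᵇ-flip (suc m) zero    = refl
<ᵇ-flip (suc m) (suc i) = <ᵇ-flip m i

sumN : ℕ → (ℕ → ℕ) → ℕ
sumN zero    g = 0
sumN (suc l) g = g 0 + sumN l (g ∘ suc)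

sumN-last : ∀ l g → sumN (suc l) g ≡ sumN l g + g l
sumN-last zero    g = +-comm (g 0) 0
sumN-last (suc l) g rewrite sumN-last l (g ∘ suc) = sym (+-assoc (g 0) _ _)

prefix-sumN : ∀ {n} l (g : ℕ → ℕ) → l ≤ n →
              sumF {n} (λ j → if toℕ j <ᵇ l then g (toℕ j) else 0) ≡ sumN l g
prefix-sumN {n}     zero    g _         = sumF-zero n
prefix-sumN {suc n} (suc l) g (s≤s l≤n) = cong (g 0 +_) (prefix-sumN l (g ∘ suc) l≤n)

count-not : ∀ {n} (p : Fin n → Bool) → count (not ∘ p) ≡ n ∸ count p
count-not {n} p = +-to-∸ (trans (+-comm _ (count p)) (begin
  count p + count (not ∘ p)             ≡⟨ sym (sumF-+ (⟦_⟧ ∘ p) (⟦_⟧ ∘ not ∘ p)) ⟩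
  sumF (λ i → ⟦ p i ⟧ + ⟦ not (p i) ⟧)  ≡⟨ sumF-cong (⟦⟧+⟦not⟧ ∘ p) ⟩
  sumF {n} (λ _ → 1)                    ≡⟨ sumF-one n ⟩
  n                                     ∎))
  where open ≡-Reasoning

count-below : ∀ {n} l → l ≤ n → count {n} (λ i → toℕ i <ᵇ l) ≡ l
count-below {n} l l≤n = trans (prefix-sumN l (λ _ → 1) l≤n) (sumN-one l)
  where
  sumN-one : ∀ l → sumN l (λ _ → 1) ≡ l
  sumN-one zero    = refl
  sumN-one (suc l) = cong suc (sumN-one l)

count-notBelow : ∀ {n} l → l ≤ n → count {n} (λ i → not (toℕ i <ᵇ l)) ≡ n ∸ l
count-notBelow {n} l l≤n = trans (count-not {n} (λ i → toℕ i <ᵇ l)) (cong (n ∸_) (count-below l l≤n))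

count-above : ∀ {n} m → m < n → count {n} (λ i → m <ᵇ toℕ i) ≡ n ∸ suc m
count-above {n} m m<n = trans (sumF-cong {n} (λ i → cong ⟦_⟧ (flipped (toℕ i))))
                              (count-notBelow (suc m) m<n)
  where
  flipped : ∀ i → (m <ᵇ i) ≡ not (i <ᵇ suc m)
  flipped i = trans (sym (not-involutive _)) (cong not (sym (<ᵇ-flip m i)))

count-atLeast : ∀ {n} m → m ≤ n → count {n} (λ i → m <ᵇ suc (toℕ i)) ≡ n ∸ m
count-atLeast {n} m m≤n =
  trans (sumF-cong {n} (λ i → cong ⟦_⟧ (<ᵇ-flip (toℕ i) m))) (count-notBelow m m≤n)

classify-first : ∀ n (j : Fin n) → classify n (j ↑ˡ (2 + n)) ≡ first j
classify-first n j with splitAt n (j ↑ˡ (2 + n)) | splitAt-↑ˡ n j (2 + n)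
... | .(inj₁ j) | refl = refl

classify-mid₀ : ∀ n → classify n (n ↑ʳ (zero ↑ˡ n)) ≡ mid zero
classify-mid₀ n with splitAt n (n ↑ʳ (zero {1} ↑ˡ n)) | splitAt-↑ʳ n (2 + n) (zero ↑ˡ n)
... | .(inj₂ (zero ↑ˡ n)) | refl = refl

classify-mid₁ : ∀ n → classify n (n ↑ʳ (suc zero ↑ˡ n)) ≡ mid (suc zero)
classify-mid₁ n with splitAt n (n ↑ʳ (suc (zero {0}) ↑ˡ n)) | splitAt-↑ʳ n (2 + n) (suc zero ↑ˡ n)
... | .(inj₂ (suc zero ↑ˡ n)) | refl = refl

classify-last : ∀ n (j : Fin n) → classify n (n ↑ʳ (2 ↑ʳ j)) ≡ last j
classify-last n j with splitAt n (n ↑ʳ (2 ↑ʳ j)) | splitAt-↑ʳ n (2 + n) (2 ↑ʳ j)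
... | .(inj₂ (2 ↑ʳ j)) | refl = refl

sumF-columns : ∀ n (h : Col n → ℕ) →
  sumF (λ q → h (classify n q)) ≡
  sumF (λ j → h (first j)) + (h (mid zero) + (h (mid (suc zero)) + sumF (λ j → h (last j))))
sumF-columns n h = trans (sumF-++ n (2 + n) (h ∘ classify n))
  (cong₂ _+_ (sumF-cong (λ j → cong h (classify-first n j)))
    (cong₂ _+_ (cong h (classify-mid₀ n))
      (cong₂ _+_ (cong h (classify-mid₁ n)) (sumF-cong (λ j → cong h (classify-last n j))))))

occupied : Color → ℕ
occupied R = 1
occupied G = 1
occupied Y = 0

occupied-split : ∀ c → occupied c ≡ ⟦ c == R ⟧ + ⟦ c == G ⟧
occupied-split R = refl
occupied-split G = refl
occupied-split Y = refl

occupied≤1 : ∀ c → occupied c ≤ 1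
occupied≤1 R = s≤s z≤n
occupied≤1 G = s≤s z≤n
occupied≤1 Y = z≤n

red≤occupied : ∀ c → ⟦ c == R ⟧ ≤ occupied c
red≤occupied R = s≤s z≤n
red≤occupied G = z≤n
red≤occupied Y = z≤n

count-occupied : ∀ {m} (f : Fin m → Color) →
                 sumF (occupied ∘ f) ≡ count (λ i → f i == R) + count (λ i → f i == G)
count-occupied {m} f = trans (sumF-cong (occupied-split ∘ f)) (sumF-+ {m} _ _)

count-yellow : ∀ {m} (f : Fin m → Color) →
               count (λ i → f i == Y) ≡ m ∸ count (λ i → f i == R) ∸ count (λ i → f i == G)
count-yellow {m} f = +-to-∸ (+-to-∸ (begin
    cY + cG + cR                  ≡⟨ rearrange cY cG cR ⟩
    cR + cG + cY                  ≡⟨ cong (_+ cY) (sym (sumF-+ {m} _ _)) ⟩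
    sumF (λ i → ⟦ f i == R ⟧ + ⟦ f i == G ⟧) + cY ≡⟨ sym (sumF-+ {m} _ _) ⟩
    sumF (λ i → ⟦ f i == R ⟧ + ⟦ f i == G ⟧ + ⟦ f i == Y ⟧) ≡⟨ sumF-cong (partition ∘ f) ⟩
    sumF {m} (λ _ → 1)            ≡⟨ sumF-one m ⟩
    m                             ∎))
  where
  open ≡-Reasoning
  cR = count (λ i → f i == R)
  cG = count (λ i → f i == G)
  cY = count (λ i → f i == Y)
  rearrange : ∀ a b c → a + b + c ≡ c + b + a
  rearrange = solve-∀
  partition : ∀ c → ⟦ c == R ⟧ + ⟦ c == G ⟧ + ⟦ c == Y ⟧ ≡ 1
  partition R = refl
  partition G = refl
  partition Y = refl

row-occupied : ∀ n (u v i : Fin n) → rowR n u v i + rowG n u v i ≡ 3 + (toℕ i + toℕ i)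
row-occupied n u v i = by-kind (⌊ i ≟F u ⌋ ∨ ⌊ i ≟F v ⌋) (toℕ i)
  where
  by-kind : ∀ b m → (if b then suc (suc m) else suc m) + (if b then suc m else suc (suc m)) ≡ 3 + (m + m)
  by-kind true  m = cong suc (+-suc (suc m) m)
  by-kind false m = cong suc (trans (+-suc m (suc m)) (cong suc (+-suc m m)))

rowsUpTo : ℕ → ℕ
rowsUpTo l = sumN l (λ m → 3 + (m + m))

colOccupied : (n k : ℕ) (α β : Fin n → ℕ) → Col n → ℕ
colOccupied n k α β x = colRG n k α β R x + colRG n k α β G x

forced : (n k : ℕ) (α β : Fin n → ℕ) → ℕ → Col n → ℕ
forced n k α β l x = colOccupied n k α β x ∸ (n ∸ l)

∸-split : ∀ {a b c} → a ≤ b → b ≤ c → c ∸ a ≡ (b ∸ a) + (c ∸ b)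
∸-split {a} {b} {c} a≤b b≤c = begin
  c ∸ a               ≡⟨ cong (_∸ a) (sym (m∸n+n≡m b≤c)) ⟩
  (c ∸ b) + b ∸ a     ≡⟨ +-∸-assoc (c ∸ b) a≤b ⟩
  (c ∸ b) + (b ∸ a)   ≡⟨ +-comm (c ∸ b) _ ⟩
  (b ∸ a) + (c ∸ b)   ∎
  where open ≡-Reasoning

forced-first-value : ∀ n l m a → m < n → l ≤ n → a ≤ 1 →
  ((n ∸ suc m) + a + 0) ∸ (n ∸ l) ≡ (if m <ᵇ l then (l ∸ suc m) + a else 0)
forced-first-value n l m a m<n l≤n a≤1 with m <? l
... | yes m<l rewrite <ᵇ-true m<l | +-identityʳ ((n ∸ suc m) + a) | ∸-split m<l l≤n
  | +-assoc (l ∸ suc m) (n ∸ l) a | +-comm (n ∸ l) a | sym (+-assoc (l ∸ suc m) a (n ∸ l)) =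
  m+n∸n≡m _ (n ∸ l)
... | no  m≮l rewrite <ᵇ-false (≮⇒≥ m≮l) = m≤n⇒m∸n≡0 (begin
  n ∸ suc m + a + 0   ≡⟨ +-identityʳ _ ⟩
  n ∸ suc m + a       ≤⟨ +-monoʳ-≤ (n ∸ suc m) a≤1 ⟩
  n ∸ suc m + 1       ≡⟨ +-comm (n ∸ suc m) 1 ⟩
  1 + (n ∸ suc m)     ≡⟨ sym (+-∸-assoc 1 m<n) ⟩
  n ∸ m               ≤⟨ ∸-monoʳ-≤ n (≮⇒≥ m≮l) ⟩
  n ∸ l               ∎)
  where open ≤-Reasoning

forced-last-value : ∀ n l m b → m < n → l ≤ n → b ≤ 1 →
  (0 + ((n ∸ m) ∸ b)) ∸ (n ∸ l) + (if m <ᵇ l then b else 0) ≡ (if m <ᵇ l then l ∸ m else 0)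
forced-last-value n l m b m<n l≤n b≤1 with m <? l
... | yes m<l rewrite <ᵇ-true m<l | ∸-split (<⇒≤ m<l) l≤n = begin
  (l ∸ m + (n ∸ l)) ∸ b ∸ (n ∸ l) + b
    ≡⟨ cong (λ x → x ∸ (n ∸ l) + b) (+-∸-comm (n ∸ l) b≤l∸m) ⟩
  (l ∸ m ∸ b + (n ∸ l)) ∸ (n ∸ l) + b
    ≡⟨ cong (_+ b) (m+n∸n≡m _ (n ∸ l)) ⟩
  l ∸ m ∸ b + b
    ≡⟨ m∸n+n≡m b≤l∸m ⟩
  l ∸ m ∎
  where
  open ≡-Reasoning
  b≤l∸m : b ≤ l ∸ m
  b≤l∸m = ≤-trans b≤1 (m<n⇒0<n∸m m<l)
... | no  m≮l rewrite <ᵇ-false (≮⇒≥ m≮l) =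
  trans (+-identityʳ _) (m≤n⇒m∸n≡0 (≤-trans (m∸n≤m (n ∸ m) b) (∸-monoʳ-≤ n (≮⇒≥ m≮l))))

staircase-identity : ∀ l →
  sumN l (λ m → l ∸ suc m) + (l + (l + sumN l (λ m → l ∸ m))) ≡ rowsUpTo l
staircase-identity zero    = refl
staircase-identity (suc l) rewrite sumN-last l (λ m → 3 + (m + m)) | sym (staircase-identity l) =
  regroup (sumN l (λ m → l ∸ suc m)) (sumN l (λ m → l ∸ m)) l
  where
  regroup : ∀ A B l → l + A + (suc l + (suc l + (suc l + B))) ≡ A + (l + (l + B)) + (3 + (l + l))
  regroup = solve-∀

module Counting (n k : ℕ) (α β : Fin n → ℕ) (1≤k : 1 ≤ k) (k≤n : k ≤ n)
                (α≤1 : ∀ j → α j ≤ 1) (β≤1 : ∀ j → β j ≤ 1) where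

  forced-firstBlock : ∀ l → l ≤ n →
    sumF (λ j → forced n k α β l (first j)) ≡ sumN l (λ m → l ∸ suc m) + prefix α l
  forced-firstBlock l l≤n = begin
    sumF (λ j → forced n k α β l (first j))
      ≡⟨ sumF-cong (λ j → forced-first-value n l (toℕ j) (α j) (toℕ<n j) l≤n (α≤1 j)) ⟩
    sumF (λ j → if toℕ j <ᵇ l then (l ∸ suc (toℕ j)) + α j else 0)
      ≡⟨ sumF-cong {n} (λ j → if-+ (toℕ j <ᵇ l) _ _) ⟩
    sumF (λ j → (if toℕ j <ᵇ l then l ∸ suc (toℕ j) else 0) + (if toℕ j <ᵇ l then α j else 0))
      ≡⟨ sumF-+ {n} _ _ ⟩
    sumF {n} (λ j → if toℕ j <ᵇ l then l ∸ suc (toℕ j) else 0) + prefix α l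
      ≡⟨ cong (_+ prefix α l) (prefix-sumN l (λ m → l ∸ suc m) l≤n) ⟩
    sumN l (λ m → l ∸ suc m) + prefix α l ∎
    where open ≡-Reasoning

  -- Both middle columns hold n occupied cells, hence ℓ of them in the first ℓ rows.
  forced-mid₀ : ∀ l → l ≤ n → forced n k α β l (mid zero) ≡ l
  forced-mid₀ l l≤n =
    trans (cong (_∸ (n ∸ l)) (m+[n∸m]≡n (≤-trans 1≤k k≤n))) (m∸[m∸n]≡n l≤n)

  forced-mid₁ : ∀ l → l ≤ n → forced n k α β l (mid (suc zero)) ≡ l
  forced-mid₁ l l≤n = trans (cong (_∸ (n ∸ l)) column-n) (m∸[m∸n]≡n l≤n)
    where
    column-n : (n ∸ k) + 1 + (k ∸ 1) ≡ n
    column-n = begin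
      (n ∸ k) + 1 + (k ∸ 1)     ≡⟨ +-assoc (n ∸ k) 1 (k ∸ 1) ⟩
      (n ∸ k) + (1 + (k ∸ 1))   ≡⟨ cong ((n ∸ k) +_) (m+[n∸m]≡n 1≤k) ⟩
      (n ∸ k) + k               ≡⟨ m∸n+n≡m k≤n ⟩
      n                         ∎
      where open ≡-Reasoning

  forced-lastBlock : ∀ l → l ≤ n →
    sumF (λ j → forced n k α β l (last j)) + prefix β l ≡ sumN l (λ m → l ∸ m)
  forced-lastBlock l l≤n = begin
    sumF (λ j → forced n k α β l (last j)) + prefix β l
      ≡⟨ sym (sumF-+ {n} _ _) ⟩
    sumF (λ j → forced n k α β l (last j) + (if toℕ j <ᵇ l then β j else 0))
      ≡⟨ sumF-cong (λ j → forced-last-value n l (toℕ j) (β j) (toℕ<n j) l≤n (β≤1 j)) ⟩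
    sumF {n} (λ j → if toℕ j <ᵇ l then l ∸ toℕ j else 0)
      ≡⟨ prefix-sumN l (λ m → l ∸ m) l≤n ⟩
    sumN l (λ m → l ∸ m) ∎
    where open ≡-Reasoning

  counting-identity : ∀ l → l ≤ n →
    sumF (λ q → forced n k α β l (classify n q)) + prefix β l ≡ rowsUpTo l + prefix α l
  counting-identity l l≤n = begin
    sumF (λ q → forced n k α β l (classify n q)) + prefix β l
      ≡⟨ cong (_+ prefix β l) (sumF-columns n (forced n k α β l)) ⟩
    (F + (M₀ + (M₁ + L))) + prefix β l
      ≡⟨ cong₂ (λ a b → (F + (a + (b + L))) + prefix β l) (forced-mid₀ l l≤n) (forced-mid₁ l l≤n) ⟩
    (F + (l + (l + L))) + prefix β l
      ≡⟨ cong (λ a → (a + (l + (l + L))) + prefix β l) (forced-firstBlock l l≤n) ⟩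
    (A + prefix α l) + (l + (l + L)) + prefix β l
      ≡⟨ regroup A (prefix α l) l L (prefix β l) ⟩
    A + (l + (l + (L + prefix β l))) + prefix α l
      ≡⟨ cong (λ a → A + (l + (l + a)) + prefix α l) (forced-lastBlock l l≤n) ⟩
    A + (l + (l + sumN l (λ m → l ∸ m))) + prefix α l
      ≡⟨ cong (_+ prefix α l) (staircase-identity l) ⟩
    rowsUpTo l + prefix α l ∎
    where
    open ≡-Reasoning
    F  = sumF (λ j → forced n k α β l (first j))
    M₀ = forced n k α β l (mid zero)
    M₁ = forced n k α β l (mid (suc zero))
    L  = sumF (λ j → forced n k α β l (last j))
    A  = sumN l (λ m → l ∸ suc m)
    regroup : ∀ A a l L b → (A + a) + (l + (l + L)) + b ≡ A + (l + (l + (L + b))) + a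
    regroup = solve-∀

sumF≤rest+prefix : ∀ {n} l → l ≤ n → (f : Fin n → ℕ) → (∀ i → f i ≤ 1) →
                   sumF f ≤ (n ∸ l) + sumF (λ i → if toℕ i <ᵇ l then f i else 0)
sumF≤rest+prefix {n} l l≤n f f≤1 = begin
  sumF f
    ≤⟨ sumF-mono (λ i → split (toℕ i <ᵇ l) (f≤1 i)) ⟩
  sumF (λ i → (if toℕ i <ᵇ l then f i else 0) + ⟦ not (toℕ i <ᵇ l) ⟧)
    ≡⟨ sumF-+ {n} _ _ ⟩
  sumF (λ i → if toℕ i <ᵇ l then f i else 0) + count {n} (λ i → not (toℕ i <ᵇ l))
    ≡⟨ cong (sumF (λ i → if toℕ i <ᵇ l then f i else 0) +_) (count-notBelow l l≤n) ⟩
  sumF (λ i → if toℕ i <ᵇ l then f i else 0) + (n ∸ l)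
    ≡⟨ +-comm _ (n ∸ l) ⟩
  (n ∸ l) + sumF (λ i → if toℕ i <ᵇ l then f i else 0) ∎
  where
  open ≤-Reasoning
  split : ∀ b {x} → x ≤ 1 → x ≤ (if b then x else 0) + ⟦ not b ⟧
  split true  {x} _   = m≤m+n x 0
  split false     x≤1 = x≤1

rowR-special : ∀ n (u v w : Fin n) → w ≡ u ⊎ w ≡ v → rowR n u v w ≡ suc (suc (toℕ w))
rowR-special n u v w (inj₁ refl) rewrite ≟-refl w = refl
rowR-special n u v w (inj₂ refl) rewrite ≟-refl w | ∨-zeroʳ ⌊ w ≟F u ⌋ = refl

module Necessity (n k : ℕ) (u v : Fin n) (α β : Fin n → ℕ) (1≤k : 1 ≤ k) (k≤n : k ≤ n)
                 (u≢v : ¬ u ≡ v) (Xα : X n k α) (Xβ : X n k β) (feasible : Instance n k u v α β) where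

  open Counting n k α β 1≤k k≤n (proj₁ Xα) (proj₁ Xβ)

  M : Fin n → Fin (n + (2 + n)) → Color
  M = proj₁ feasible

  rows : ∀ i c → count (λ q → M i q == c) ≡ rowProj n u v c i
  rows = proj₁ (proj₂ feasible)

  cols : ∀ q c → count (λ i → M i q == c) ≡ colProj n k α β c q
  cols = proj₂ (proj₂ feasible)

  occupiedUpTo : Fin (n + (2 + n)) → ℕ → ℕ
  occupiedUpTo q l = sumF (λ i → if toℕ i <ᵇ l then occupied (M i q) else 0)

  forced≤occupiedUpTo : ∀ l → l ≤ n → ∀ q → forced n k α β l (classify n q) ≤ occupiedUpTo q l
  forced≤occupiedUpTo l l≤n q = m≤n+o⇒m∸n≤o _ (n ∸ l) (begin
    colOccupied n k α β (classify n q)  ≡⟨ sym (column-occupied q) ⟩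
    sumF (λ i → occupied (M i q))       ≤⟨ sumF≤rest+prefix l l≤n _ (λ i → occupied≤1 (M i q)) ⟩
    (n ∸ l) + occupiedUpTo q l          ∎)
    where
    open ≤-Reasoning
    column-occupied : ∀ q → sumF (λ i → occupied (M i q)) ≡ colOccupied n k α β (classify n q)
    column-occupied q = trans (count-occupied (λ i → M i q)) (cong₂ _+_ (cols q R) (cols q G))

  occupied-firstRows : ∀ l → l ≤ n → sumF (λ q → occupiedUpTo q l) ≡ rowsUpTo l
  occupied-firstRows l l≤n = begin
    sumF (λ q → occupiedUpTo q l)
      ≡⟨ sumF-comm (n + (2 + n)) n (λ q i → if toℕ i <ᵇ l then occupied (M i q) else 0) ⟩
    sumF {n} (λ i → sumF (λ q → if toℕ i <ᵇ l then occupied (M i q) else 0))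
      ≡⟨ sumF-cong {n} (λ i → trans (sumF-if (toℕ i <ᵇ l) (occupied ∘ M i))
                                    (cong (λ x → if toℕ i <ᵇ l then x else 0) (row-count i))) ⟩
    sumF {n} (λ i → if toℕ i <ᵇ l then 3 + (toℕ i + toℕ i) else 0)
      ≡⟨ prefix-sumN l (λ m → 3 + (m + m)) l≤n ⟩
    rowsUpTo l ∎
    where
    open ≡-Reasoning
    row-count : ∀ i → sumF (occupied ∘ M i) ≡ 3 + (toℕ i + toℕ i)
    row-count i =
      trans (count-occupied (M i)) (trans (cong₂ _+_ (rows i R) (rows i G)) (row-occupied n u v i))

  -- The forced counts can only sum to rowsUpTo ℓ if α ⪯ β.
  dominance : α ⪯ β
  dominance l _ l≤n = +-cancelˡ-≤ (rowsUpTo l) _ _ (begin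
    rowsUpTo l + prefix α l
      ≡⟨ sym (counting-identity l l≤n) ⟩
    sumF (λ q → forced n k α β l (classify n q)) + prefix β l
      ≤⟨ +-monoˡ-≤ (prefix β l) (sumF-mono (forced≤occupiedUpTo l l≤n)) ⟩
    sumF (λ q → occupiedUpTo q l) + prefix β l
      ≡⟨ cong (_+ prefix β l) (occupied-firstRows l l≤n) ⟩
    rowsUpTo l + prefix β l ∎)
    where open ≤-Reasoning

  tight : (∀ j → α j ≡ β j) → ∀ l → l ≤ n → ∀ q →
          occupiedUpTo q l ≤ forced n k α β l (classify n q)
  tight α≡β l l≤n = sumF-tight (λ q → occupiedUpTo q l) _ (forced≤occupiedUpTo l l≤n)
    (≤-reflexive (trans (occupied-firstRows l l≤n) (sym forced-sum)))
    where
    same-prefix : prefix α l ≡ prefix β l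
    same-prefix = sumF-cong (λ j → cong (λ x → if toℕ j <ᵇ l then x else 0) (α≡β j))
    forced-sum : sumF (λ q → forced n k α β l (classify n q)) ≡ rowsUpTo l
    forced-sum = +-cancelʳ-≡ (prefix β l) _ _
      (trans (counting-identity l l≤n) (cong (rowsUpTo l +_) same-prefix))

  middle₀ : Fin (n + (2 + n))
  middle₀ = n ↑ʳ zero

  -- In the tight case, a row w with α_w = 0 has no red cell in a first-block
  -- column j ≥ w: all occupied cells of those columns lie in rows other than w.
  no-red-right : (∀ j → α j ≡ β j) → ∀ w → α w ≡ 0 → ∀ j → toℕ w ≤ toℕ j →
                 ⟦ M w (j ↑ˡ (2 + n)) == R ⟧ ≤ 0
  no-red-right α≡β w αw≡0 j w≤j = begin
    ⟦ M w q == R ⟧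
      ≤⟨ red≤occupied (M w q) ⟩
    occupied (M w q)
      ≤⟨ in-row-w ⟩
    occupiedUpTo q l
      ≤⟨ tight α≡β l (toℕ<n w) q ⟩
    forced n k α β l (classify n q)
      ≡⟨ cong (forced n k α β l) (classify-first n j) ⟩
    forced n k α β l (first j)
      ≡⟨ forced-first-value n l (toℕ j) (α j) (toℕ<n j) (toℕ<n w) (proj₁ Xα j) ⟩
    (if toℕ j <ᵇ l then (l ∸ suc (toℕ j)) + α j else 0)
      ≡⟨ vanishes ⟩
    0 ∎
    where
    open ≤-Reasoning
    q = j ↑ˡ (2 + n)
    l = suc (toℕ w)
    in-row-w : occupied (M w q) ≤ occupiedUpTo q l
    in-row-w = subst (λ b → (if b then occupied (M w q) else 0) ≤ occupiedUpTo q l)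
                     (<ᵇ-true (n<1+n (toℕ w)))
                     (term≤sumF (λ i → if toℕ i <ᵇ l then occupied (M i q) else 0) w)
    vanishes : (if toℕ j <ᵇ l then (l ∸ suc (toℕ j)) + α j else 0) ≡ 0
    vanishes with toℕ j <? l
    ... | no  j≮l rewrite <ᵇ-false (≮⇒≥ j≮l) = refl
    ... | yes j<l rewrite <ᵇ-true j<l | toℕ-injective (≤-antisym (≤-pred j<l) w≤j)
                        | n∸n≡0 (toℕ w) = αw≡0

  reds-in-row : (∀ j → α j ≡ β j) → ∀ w → α w ≡ 0 →
                count (λ q → M w q == R) ≤ suc (toℕ w) + ⟦ M w middle₀ == R ⟧
  reds-in-row α≡β w αw≡0 = begin
    count (λ q → M w q == R)
      ≡⟨ sumF-++ n (2 + n) (λ q → ⟦ M w q == R ⟧) ⟩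
    sumF (λ j → red (j ↑ˡ (2 + n)))
      + (red middle₀ + (red (n ↑ʳ suc zero) + sumF (λ j → red (n ↑ʳ (2 ↑ʳ j)))))
      ≤⟨ +-mono-≤ (sumF-mono {n} left-of-w) (+-monoʳ-≤ (red middle₀)
           (+-mono-≤ (⟦⟧≤1 _) (≤-trans (sumF-mono {n} last-not-red) (≤-reflexive (sumF-zero n))))) ⟩
    count {n} (λ j → toℕ j <ᵇ toℕ w) + (red middle₀ + (1 + 0))
      ≡⟨ cong (_+ (red middle₀ + 1)) (count-below (toℕ w) (<⇒≤ (toℕ<n w))) ⟩
    toℕ w + (red middle₀ + (1 + 0))
      ≡⟨ regroup (toℕ w) (red middle₀) ⟩
    suc (toℕ w) + red middle₀ ∎
    where
    open ≤-Reasoning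
    red : Fin (n + (2 + n)) → ℕ
    red q = ⟦ M w q == R ⟧
    left-of-w : ∀ j → red (j ↑ˡ (2 + n)) ≤ ⟦ toℕ j <ᵇ toℕ w ⟧
    left-of-w j with toℕ j <? toℕ w
    ... | yes j<w rewrite <ᵇ-true j<w = ⟦⟧≤1 _
    ... | no  j≮w rewrite <ᵇ-false (≮⇒≥ j≮w) = no-red-right α≡β w αw≡0 j (≮⇒≥ j≮w)
    last-not-red : ∀ j → red (n ↑ʳ (2 ↑ʳ j)) ≤ 0
    last-not-red j = ≤-trans (term≤sumF (λ i → ⟦ M i q == R ⟧) w)
                             (≤-reflexive (trans (cols q R) (cong (colRG n k α β R) (classify-last n j))))
      where q = n ↑ʳ (2 ↑ʳ j)
    regroup : ∀ w r → w + (r + (1 + 0)) ≡ suc w + r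
    regroup = solve-∀

  red-in-middle₀ : (∀ j → α j ≡ β j) → ∀ w → w ≡ u ⊎ w ≡ v → α w ≡ 0 →
                   1 ≤ ⟦ M w middle₀ == R ⟧
  red-in-middle₀ α≡β w special αw≡0 = +-cancelˡ-≤ (suc (toℕ w)) 1 _ (begin
    suc (toℕ w) + 1               ≡⟨ +-comm (suc (toℕ w)) 1 ⟩
    suc (suc (toℕ w))             ≡⟨ sym (rowR-special n u v w special) ⟩
    rowR n u v w                  ≡⟨ sym (rows w R) ⟩
    count (λ q → M w q == R)      ≤⟨ reds-in-row α≡β w αw≡0 ⟩
    suc (toℕ w) + ⟦ M w middle₀ == R ⟧ ∎)
    where open ≤-Reasoning

  -- Column n+1 has a single red cell, so α_u and α_v cannot both vanish.
  special-one : (∀ j → α j ≡ β j) → 1 ≤ α u + α v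
  special-one α≡β with n≤1⇒n≡0∨n≡1 (proj₁ Xα u) | n≤1⇒n≡0∨n≡1 (proj₁ Xα v)
  ... | inj₂ αu≡1 | _         rewrite αu≡1 = s≤s z≤n
  ... | inj₁ αu≡0 | inj₂ αv≡1 rewrite αu≡0 | αv≡1 = s≤s z≤n
  ... | inj₁ αu≡0 | inj₁ αv≡0 = ⊥-elim (1+n≰n (begin
    2
      ≤⟨ +-mono-≤ (red-in-middle₀ α≡β u (inj₁ refl) αu≡0) (red-in-middle₀ α≡β v (inj₂ refl) αv≡0) ⟩
    ⟦ M u middle₀ == R ⟧ + ⟦ M v middle₀ == R ⟧
      ≤⟨ two-terms≤sumF (λ i → ⟦ M i middle₀ == R ⟧) u v u≢v ⟩
    count (λ i → M i middle₀ == R)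
      ≡⟨ trans (cols middle₀ R) (cong (colRG n k α β R) (classify-mid₀ n)) ⟩
    1 ∎))
    where open ≤-Reasoning

special : ∀ {n} (u v i : Fin n) → Bool
special u v i = ⌊ i ≟F u ⌋ ∨ ⌊ i ≟F v ⌋

rowR-form : ∀ n (u v i : Fin n) → rowR n u v i ≡ toℕ i + (1 + ⟦ special u v i ⟧)
rowR-form n u v i with special u v i
... | true  = sym (+-comm (toℕ i) 2)
... | false = sym (+-comm (toℕ i) 1)

rowG-form : ∀ n (u v i : Fin n) → rowG n u v i + (1 + ⟦ special u v i ⟧) ≡ 3 + toℕ i
rowG-form n u v i with special u v i
... | true  = +-comm (suc (toℕ i)) 2
... | false = +-comm (suc (suc (toℕ i))) 1

⟦select⟧ : ∀ b {c₁ c₂} c → (c₁ == c) ≡ true → (c₂ == c) ≡ false →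
           ⟦ (if b then c₁ else c₂) == c ⟧ ≡ ⟦ b ⟧
⟦select⟧ true  c p _ rewrite p = refl
⟦select⟧ false c _ q rewrite q = refl

⟦reject⟧ : ∀ b {c₁ c₂} c → (c₁ == c) ≡ false → (c₂ == c) ≡ true →
           ⟦ (if b then c₁ else c₂) == c ⟧ ≡ ⟦ not b ⟧
⟦reject⟧ true  c p _ rewrite p = refl
⟦reject⟧ false c _ q rewrite q = refl

count-select : ∀ {m} (b : Fin m → Bool) {c₁ c₂} c → (c₁ == c) ≡ true → (c₂ == c) ≡ false →
               count (λ i → (if b i then c₁ else c₂) == c) ≡ count b
count-select b c p q = sumF-cong (λ i → ⟦select⟧ (b i) c p q)

count-reject : ∀ {m} (b : Fin m → Bool) {c₁ c₂} c → (c₁ == c) ≡ false → (c₂ == c) ≡ true →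
               count (λ i → (if b i then c₁ else c₂) == c) ≡ count (not ∘ b)
count-reject b c p q = sumF-cong (λ i → ⟦reject⟧ (b i) c p q)

count-absent : ∀ {m} (b : Fin m → Bool) {c₁ c₂} c → (c₁ == c) ≡ false → (c₂ == c) ≡ false →
               count (λ i → (if b i then c₁ else c₂) == c) ≡ 0
count-absent {m} b {c₁} {c₂} c p q = trans (sumF-cong (λ i → absent (b i))) (sumF-zero m)
  where
  absent : ∀ x → ⟦ (if x then c₁ else c₂) == c ⟧ ≡ 0
  absent true  rewrite p = refl
  absent false rewrite q = refl

-- Staircases: cell (i, j) of the first block is red iff j < i + α_j, i.e. j < i
-- or j = i with α_j = 1; cell (i, j) of the last block is green iff
-- j + β_j < i + 1, i.e. j < i or j = i with β_j = 0.

staircase-red : ∀ {n} (j i : Fin n) a → a ≤ 1 →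
  ⟦ toℕ j <ᵇ toℕ i + a ⟧ ≡ ⟦ toℕ j <ᵇ toℕ i ⟧ + (if ⌊ j ≟F i ⌋ then a else 0)
staircase-red j i a a≤1 with j ≟F i
... | yes refl rewrite <ᵇ-false (≤-refl {toℕ j}) with n≤1⇒n≡0∨n≡1 a≤1
...   | inj₁ refl rewrite +-identityʳ (toℕ j) | <ᵇ-false (≤-refl {toℕ j}) = refl
...   | inj₂ refl rewrite <ᵇ-true (≤-reflexive (+-comm 1 (toℕ j))) = refl
staircase-red j i a a≤1 | no j≢i with <-cmp (toℕ j) (toℕ i)
... | tri< j<i _ _ rewrite <ᵇ-true j<i | <ᵇ-true (≤-trans j<i (m≤m+n (toℕ i) a)) = refl
... | tri≈ _ j≡i _ = ⊥-elim (j≢i (toℕ-injective j≡i))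
... | tri> _ _ j>i rewrite <ᵇ-false (<⇒≤ j>i)
                         | <ᵇ-false (≤-trans (+-monoʳ-≤ (toℕ i) a≤1)
                                             (≤-trans (≤-reflexive (+-comm (toℕ i) 1)) j>i)) = refl

staircase-green : ∀ {n} (j i : Fin n) b → b ≤ 1 →
  ⟦ toℕ j + b <ᵇ suc (toℕ i) ⟧ + (if ⌊ j ≟F i ⌋ then b else 0) ≡ ⟦ toℕ j <ᵇ suc (toℕ i) ⟧
staircase-green j i b b≤1 with j ≟F i
... | yes refl rewrite <ᵇ-true (≤-refl {suc (toℕ j)}) with n≤1⇒n≡0∨n≡1 b≤1
...   | inj₁ refl rewrite +-identityʳ (toℕ j) | <ᵇ-true (≤-refl {suc (toℕ j)}) = refl
...   | inj₂ refl rewrite <ᵇ-false (≤-reflexive (+-comm 1 (toℕ j))) = refl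
staircase-green j i b b≤1 | no j≢i with <-cmp (toℕ j) (toℕ i)
... | tri< j<i _ _ rewrite <ᵇ-true (s≤s (<⇒≤ j<i))
                         | <ᵇ-true (s≤s (≤-trans (+-monoʳ-≤ (toℕ j) b≤1)
                                                 (≤-trans (≤-reflexive (+-comm (toℕ j) 1)) j<i))) = refl
... | tri≈ _ j≡i _ = ⊥-elim (j≢i (toℕ-injective j≡i))
... | tri> _ _ j>i rewrite <ᵇ-false {toℕ j} {suc (toℕ i)} j>i
                         | <ᵇ-false (≤-trans j>i (m≤m+n (toℕ j) b)) = refl

-- The red cell of row i in column n+2 is chosen so that every row gets the
-- right number of red cells:  red₁ + a + d = 1 + e, where e says the row is
-- special, d that it is the row w marked in column n+1 (only special rows are),
-- and a = α_i (a special row with α_i = 0 is marked).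
row-balance : ∀ (e d : Bool) a → a ≤ 1 →
              (d ≡ true → e ≡ true) → (e ≡ true → a ≡ 0 → d ≡ true) →
              ⟦ ⌊ ⟦ e ⟧ ≟ a + ⟦ d ⟧ ⌋ ⟧ + a + ⟦ d ⟧ ≡ 1 + ⟦ e ⟧
row-balance e     d     a a≤1 d⇒e e⇒d with n≤1⇒n≡0∨n≡1 a≤1
row-balance false false a a≤1 d⇒e e⇒d | inj₁ refl = refl
row-balance false false a a≤1 d⇒e e⇒d | inj₂ refl = refl
row-balance false true  a a≤1 d⇒e e⇒d | _ with d⇒e refl
... | ()
row-balance true  false a a≤1 d⇒e e⇒d | inj₁ refl with e⇒d refl refl
... | ()
row-balance true  false a a≤1 d⇒e e⇒d | inj₂ refl = refl
row-balance true  true  a a≤1 d⇒e e⇒d | inj₁ refl = refl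
row-balance true  true  a a≤1 d⇒e e⇒d | inj₂ refl = refl

module Construction (n k : ℕ) (u v : Fin n) (α β : Fin n → ℕ) (1≤k : 1 ≤ k) (k≤n : k ≤ n)
  (u≢v : ¬ u ≡ v) (Xα : X n k α) (Xβ : X n k β) (α≡β : ∀ j → α j ≡ β j) (w : Fin n)
  (marked⇒special : ∀ i → ⌊ i ≟F w ⌋ ≡ true → special u v i ≡ true)
  (special⇒marked : ∀ i → special u v i ≡ true → α i ≡ 0 → ⌊ i ≟F w ⌋ ≡ true) where

  marked : Fin n → Bool
  marked i = ⌊ i ≟F w ⌋

  red₁ : Fin n → Bool
  red₁ i = ⌊ ⟦ special u v i ⟧ ≟ α i + ⟦ marked i ⟧ ⌋

  cell : Fin n → Col n → Color
  cell i (first j)        = if toℕ j <ᵇ toℕ i + α j then R else Y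
  cell i (mid zero)       = if marked i then R else G
  cell i (mid (suc zero)) = if red₁ i then R else G
  cell i (last j)         = if toℕ j + β j <ᵇ suc (toℕ i) then G else Y

  M : Fin n → Fin (n + (2 + n)) → Color
  M i q = cell i (classify n q)

  balance : ∀ i → ⟦ red₁ i ⟧ + α i + ⟦ marked i ⟧ ≡ 1 + ⟦ special u v i ⟧
  balance i = row-balance (special u v i) (marked i) (α i) (proj₁ Xα i)
                          (marked⇒special i) (special⇒marked i)

  count-special : count (special u v) ≡ 2
  count-special = begin
    count (special u v)
      ≡⟨ sumF-cong split ⟩
    sumF {n} (λ i → ⟦ ⌊ i ≟F u ⌋ ⟧ + ⟦ ⌊ i ≟F v ⌋ ⟧)
      ≡⟨ sumF-+ {n} _ _ ⟩
    count {n} (λ i → ⌊ i ≟F u ⌋) + count {n} (λ i → ⌊ i ≟F v ⌋)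
      ≡⟨ cong₂ _+_ (sumF-pick (λ _ → 1) u) (sumF-pick (λ _ → 1) v) ⟩
    2 ∎
    where
    open ≡-Reasoning
    split : ∀ i → ⟦ special u v i ⟧ ≡ ⟦ ⌊ i ≟F u ⌋ ⟧ + ⟦ ⌊ i ≟F v ⌋ ⟧
    split i with i ≟F u | i ≟F v
    ... | yes refl | yes refl = ⊥-elim (u≢v refl)
    ... | yes _    | no  _    = refl
    ... | no  _    | yes _    = refl
    ... | no  _    | no  _    = refl

  count-marked : count marked ≡ 1
  count-marked = sumF-pick (λ _ → 1) w

  -- Summing row-balance over all rows: n + 2 = #red₁ + k + 1.
  count-red₁ : count red₁ ≡ (n ∸ k) + 1
  count-red₁ = +-cancelʳ-≡ (k + 1) _ _ (begin
    S + (k + 1)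
      ≡⟨ cong₂ (λ a b → S + (a + b)) (sym (proj₂ Xα)) (sym count-marked) ⟩
    S + (sumF α + count marked)
      ≡⟨ sym (+-assoc S _ _) ⟩
    S + sumF α + count marked
      ≡⟨ cong (_+ count marked) (sym (sumF-+ {n} _ _)) ⟩
    sumF {n} (λ i → ⟦ red₁ i ⟧ + α i) + count marked
      ≡⟨ sym (sumF-+ {n} _ _) ⟩
    sumF {n} (λ i → ⟦ red₁ i ⟧ + α i + ⟦ marked i ⟧)
      ≡⟨ sumF-cong balance ⟩
    sumF {n} (λ i → 1 + ⟦ special u v i ⟧)
      ≡⟨ sumF-+ {n} _ _ ⟩
    sumF {n} (λ _ → 1) + count (special u v)
      ≡⟨ cong₂ _+_ (sumF-one n) count-special ⟩
    n + 2
      ≡⟨ cong (_+ 2) (sym (m∸n+n≡m k≤n)) ⟩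
    (n ∸ k) + k + 2
      ≡⟨ regroup (n ∸ k) k ⟩
    (n ∸ k) + 1 + (k + 1) ∎)
    where
    open ≡-Reasoning
    S = count red₁
    regroup : ∀ a b → a + b + 2 ≡ a + 1 + (b + 1)
    regroup = solve-∀

  reds-first-column : ∀ j → count {n} (λ i → cell i (first j) == R) ≡ (n ∸ suc (toℕ j)) + α j
  reds-first-column j = begin
    count {n} (λ i → cell i (first j) == R)
      ≡⟨ sumF-cong {n} (λ i → trans (⟦select⟧ _ R refl refl)
                                    (staircase-red j i (α j) (proj₁ Xα j))) ⟩
    sumF {n} (λ i → ⟦ toℕ j <ᵇ toℕ i ⟧ + (if ⌊ j ≟F i ⌋ then α j else 0))
      ≡⟨ sumF-+ {n} _ _ ⟩
    count {n} (λ i → toℕ j <ᵇ toℕ i) + sumF {n} (λ i → if ⌊ j ≟F i ⌋ then α j else 0)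
      ≡⟨ cong₂ _+_ (count-above (toℕ j) (toℕ<n j)) (sumF-pickʳ (λ _ → α j) j) ⟩
    (n ∸ suc (toℕ j)) + α j ∎
    where open ≡-Reasoning

  greens-last-column : ∀ j → count {n} (λ i → cell i (last j) == G) + β j ≡ n ∸ toℕ j
  greens-last-column j = begin
    count {n} (λ i → cell i (last j) == G) + β j
      ≡⟨ cong₂ _+_ (count-select {n} _ G refl refl) (sym (sumF-pickʳ (λ _ → β j) j)) ⟩
    count {n} (λ i → toℕ j + β j <ᵇ suc (toℕ i)) + sumF {n} (λ i → if ⌊ j ≟F i ⌋ then β j else 0)
      ≡⟨ sym (sumF-+ {n} _ _) ⟩
    sumF {n} (λ i → ⟦ toℕ j + β j <ᵇ suc (toℕ i) ⟧ + (if ⌊ j ≟F i ⌋ then β j else 0))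
      ≡⟨ sumF-cong {n} (λ i → staircase-green j i (β j) (proj₁ Xβ j)) ⟩
    count {n} (λ i → toℕ j <ᵇ suc (toℕ i))
      ≡⟨ count-atLeast (toℕ j) (<⇒≤ (toℕ<n j)) ⟩
    n ∸ toℕ j ∎
    where open ≡-Reasoning

  column-counts : ∀ x → count {n} (λ i → cell i x == R) ≡ colRG n k α β R x
                      × count {n} (λ i → cell i x == G) ≡ colRG n k α β G x
  column-counts (first j) =
    reds-first-column j ,
    count-absent {n} (λ i → toℕ j <ᵇ toℕ i + α j) G refl refl
  column-counts (mid zero) =
    trans (count-select marked R refl refl) count-marked ,
    trans (count-reject marked G refl refl) (trans (count-not marked) (cong (n ∸_) count-marked))
  column-counts (mid (suc zero)) =
    trans (count-select red₁ R refl refl) count-red₁ ,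
    trans (count-reject red₁ G refl refl)
          (trans (count-not red₁) (trans (cong (n ∸_) count-red₁) (sym (+-to-∸ complement))))
    where
    complement : (k ∸ 1) + ((n ∸ k) + 1) ≡ n
    complement = trans (+-comm (k ∸ 1) _) (trans (+-assoc (n ∸ k) 1 _)
                   (trans (cong ((n ∸ k) +_) (m+[n∸m]≡n 1≤k)) (m∸n+n≡m k≤n)))
  column-counts (last j) =
    count-absent {n} (λ i → toℕ j + β j <ᵇ suc (toℕ i)) R refl refl ,
    +-to-∸ (greens-last-column j)

  columns-ok : (q : Fin (n + (2 + n))) (c : Color) →
               count {n} (λ i → M i q == c) ≡ colProj n k α β c q
  columns-ok q R = proj₁ (column-counts (classify n q))
  columns-ok q G = proj₂ (column-counts (classify n q))
  columns-ok q Y = trans (count-yellow (λ i → M i q))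
    (cong₂ _∸_ (cong (n ∸_) (columns-ok q R)) (columns-ok q G))

  reds-first-row : ∀ i → count {n} (λ j → cell i (first j) == R) ≡ toℕ i + α i
  reds-first-row i = begin
    count {n} (λ j → cell i (first j) == R)
      ≡⟨ sumF-cong {n} (λ j → trans (⟦select⟧ _ R refl refl)
                                    (staircase-red j i (α j) (proj₁ Xα j))) ⟩
    sumF {n} (λ j → ⟦ toℕ j <ᵇ toℕ i ⟧ + (if ⌊ j ≟F i ⌋ then α j else 0))
      ≡⟨ sumF-+ {n} _ _ ⟩
    count {n} (λ j → toℕ j <ᵇ toℕ i) + sumF {n} (λ j → if ⌊ j ≟F i ⌋ then α j else 0)
      ≡⟨ cong₂ _+_ (count-below (toℕ i) (<⇒≤ (toℕ<n i))) (sumF-pick α i) ⟩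
    toℕ i + α i ∎
    where open ≡-Reasoning

  greens-last-row : ∀ i → count {n} (λ j → cell i (last j) == G) + α i ≡ suc (toℕ i)
  greens-last-row i = begin
    count {n} (λ j → cell i (last j) == G) + α i
      ≡⟨ cong₂ _+_ (count-select {n} _ G refl refl) (trans (α≡β i) (sym (sumF-pick β i))) ⟩
    count {n} (λ j → toℕ j + β j <ᵇ suc (toℕ i)) + sumF {n} (λ j → if ⌊ j ≟F i ⌋ then β j else 0)
      ≡⟨ sym (sumF-+ {n} _ _) ⟩
    sumF {n} (λ j → ⟦ toℕ j + β j <ᵇ suc (toℕ i) ⟧ + (if ⌊ j ≟F i ⌋ then β j else 0))
      ≡⟨ sumF-cong {n} (λ j → staircase-green j i (β j) (proj₁ Xβ j)) ⟩
    count {n} (λ j → toℕ j <ᵇ suc (toℕ i))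
      ≡⟨ count-below (suc (toℕ i)) (toℕ<n i) ⟩
    suc (toℕ i) ∎
    where open ≡-Reasoning

  reds-row : ∀ i → count (λ q → M i q == R) ≡ rowR n u v i
  reds-row i = begin
    count (λ q → M i q == R)
      ≡⟨ sumF-columns n (λ x → ⟦ cell i x == R ⟧) ⟩
    F + (⟦ cell i (mid zero) == R ⟧ + (⟦ cell i (mid (suc zero)) == R ⟧ + L))
      ≡⟨ cong₂ _+_ (reds-first-row i) (cong₂ _+_ (⟦select⟧ (marked i) R refl refl)
                                                 (cong₂ _+_ (⟦select⟧ (red₁ i) R refl refl) no-red-last)) ⟩
    (toℕ i + α i) + (⟦ marked i ⟧ + (⟦ red₁ i ⟧ + 0))
      ≡⟨ regroup (toℕ i) (α i) ⟦ marked i ⟧ ⟦ red₁ i ⟧ ⟩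
    toℕ i + (⟦ red₁ i ⟧ + α i + ⟦ marked i ⟧)
      ≡⟨ cong (toℕ i +_) (balance i) ⟩
    toℕ i + (1 + ⟦ special u v i ⟧)
      ≡⟨ sym (rowR-form n u v i) ⟩
    rowR n u v i ∎
    where
    open ≡-Reasoning
    F = count {n} (λ j → cell i (first j) == R)
    L = count {n} (λ j → cell i (last j) == R)
    no-red-last : L ≡ 0
    no-red-last = count-absent {n} (λ j → toℕ j + β j <ᵇ suc (toℕ i)) R refl refl
    regroup : ∀ t a d r → (t + a) + (d + (r + 0)) ≡ t + (r + a + d)
    regroup = solve-∀

  -- The green count follows from  greens + (red₁ + α_i + marked) = i + 3.
  greens-row : ∀ i → count (λ q → M i q == G) ≡ rowG n u v i
  greens-row i = +-cancelʳ-≡ (1 + ⟦ special u v i ⟧) _ _ (begin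
    count (λ q → M i q == G) + (1 + ⟦ special u v i ⟧)
      ≡⟨ cong₂ _+_ (sumF-columns n (λ x → ⟦ cell i x == G ⟧)) (sym (balance i)) ⟩
    (F + (⟦ cell i (mid zero) == G ⟧ + (⟦ cell i (mid (suc zero)) == G ⟧ + L))) + B
      ≡⟨ cong (_+ B) (cong₂ _+_ no-green-first (cong₂ _+_ (⟦reject⟧ (marked i) G refl refl)
                                                         (cong (_+ L) (⟦reject⟧ (red₁ i) G refl refl)))) ⟩
    (0 + (⟦ not (marked i) ⟧ + (⟦ not (red₁ i) ⟧ + L))) + B
      ≡⟨ regroup ⟦ not (marked i) ⟧ ⟦ marked i ⟧ ⟦ not (red₁ i) ⟧ ⟦ red₁ i ⟧ L (α i) ⟩
    (⟦ marked i ⟧ + ⟦ not (marked i) ⟧) + (⟦ red₁ i ⟧ + ⟦ not (red₁ i) ⟧) + (L + α i)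
      ≡⟨ cong₂ _+_ (cong₂ _+_ (⟦⟧+⟦not⟧ (marked i)) (⟦⟧+⟦not⟧ (red₁ i))) (greens-last-row i) ⟩
    3 + toℕ i
      ≡⟨ sym (rowG-form n u v i) ⟩
    rowG n u v i + (1 + ⟦ special u v i ⟧) ∎)
    where
    open ≡-Reasoning
    F = count {n} (λ j → cell i (first j) == G)
    L = count {n} (λ j → cell i (last j) == G)
    B = ⟦ red₁ i ⟧ + α i + ⟦ marked i ⟧
    no-green-first : F ≡ 0
    no-green-first = count-absent {n} (λ j → toℕ j <ᵇ toℕ i + α j) G refl refl
    regroup : ∀ d′ d r′ r L a → (0 + (d′ + (r′ + L))) + (r + a + d) ≡ (d + d′) + (r + r′) + (L + a)
    regroup = solve-∀

  rows-ok : (i : Fin n) (c : Color) → count (λ q → M i q == c) ≡ rowProj n u v c i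
  rows-ok i R = reds-row i
  rows-ok i G = greens-row i
  rows-ok i Y = trans (count-yellow (M i))
    (cong₂ _∸_ (cong₂ _∸_ (+-comm n (2 + n)) (reds-row i)) (greens-row i))

  feasible : Instance n k u v α β
  feasible = M , rows-ok , columns-ok

special-cases : ∀ {n} (u v i : Fin n) → special u v i ≡ true → i ≡ u ⊎ i ≡ v
special-cases u v i h with i ≟F u | i ≟F v
... | yes i≡u | _       = inj₁ i≡u
... | no  _   | yes i≡v = inj₂ i≡v

-- The marked row: v if α_v = 0, else u.  It is special, and because
-- α_u + α_v ≥ 1 it is the only special row with α = 0.
marker : ∀ {n} (u v : Fin n) (α : Fin n → ℕ) → 1 ≤ α u + α v →
  Σ (Fin n) λ w → (∀ i → ⌊ i ≟F w ⌋ ≡ true → special u v i ≡ true)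
                × (∀ i → special u v i ≡ true → α i ≡ 0 → ⌊ i ≟F w ⌋ ≡ true)
marker u v α 1≤αu+αv with α v ≟ 0
... | yes αv≡0 = v , (λ i i≡v → trans (cong (⌊ i ≟F u ⌋ ∨_) i≡v) (∨-zeroʳ _)) , only-v
  where
  only-v : ∀ i → special u v i ≡ true → α i ≡ 0 → ⌊ i ≟F v ⌋ ≡ true
  only-v i si αi≡0 with special-cases u v i si
  ... | inj₂ refl = ≟-refl i
  ... | inj₁ refl = ⊥-elim (1+n≰n {0} (subst (1 ≤_) (cong₂ _+_ αi≡0 αv≡0) 1≤αu+αv))
... | no  αv≢0 = u , (λ i i≡u → cong (_∨ ⌊ i ≟F v ⌋) i≡u) , only-u
  where
  only-u : ∀ i → special u v i ≡ true → α i ≡ 0 → ⌊ i ≟F u ⌋ ≡ true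
  only-u i si αi≡0 with special-cases u v i si
  ... | inj₁ refl = ≟-refl i
  ... | inj₂ refl = ⊥-elim (αv≢0 αi≡0)

lemma4 : (n k : ℕ) (u v : Fin n) (α β : Fin n → ℕ) →
         1 ≤ k → k ≤ n → ¬ (u ≡ v) → X n k α → X n k β →
         (Instance n k u v α β → α ⪯ β) ×
         (((j : Fin n) → α j ≡ β j) → (Instance n k u v α β ⇔ 1 ≤ α u + α v))
lemma4 n k u v α β 1≤k k≤n u≢v Xα Xβ = necessary , equal-case
  where
  module Nec = Necessity n k u v α β 1≤k k≤n u≢v Xα Xβ

  necessary : Instance n k u v α β → α ⪯ β
  necessary feasible = Nec.dominance feasible

  equal-case : (∀ j → α j ≡ β j) → Instance n k u v α β ⇔ 1 ≤ α u + α v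
  equal-case α≡β = mk⇔ (λ feasible → Nec.special-one feasible α≡β) sufficient
    where
    sufficient : 1 ≤ α u + α v → Instance n k u v α β
    sufficient h with marker u v α h
    ... | w , marked⇒special , special⇒marked =
      Construction.feasible n k u v α β 1≤k k≤n u≢v Xα Xβ α≡β w marked⇒special special⇒marked
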